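{- Let $r\ge2$, $s\mid r$, $\xi_s$ a primitive $s$-th root of unity, and let $P\in\mathbb{F}_q[X]$ be monic irreducible of degree $n$. Then for every integer $d\ge0$, $$[u^d] H_{r;s}(u;P) = \sum_{a=0}^{\lfloor d/n\rfloor} \left(-\frac{\phi(r)}{\phi(s)}\right)^a \sum_{\substack{i_1,\dots,i_a\in\{1,\dots,s\} \\ (i_j,s)=1}} \xi_s^{n(i_1+\cdots+i_a) } [u^{d-an}] H_{r;s}(u;1).$$
   Context: $\phi$ is Euler's totient; $[u^d]K(u)$ denotes the coefficient of $u^d$ in a power series $K$. For nonzero $G\in\mathbb{F}_q[X]$, $H_{r;s}(u;G) = \prod_{Q\nmid G} \left(1+ \frac{\phi(r)}{\phi(s)} \sum_{1\le i\le s,(i,s)=1} (\xi_s^i u)^{\deg(Q)} \right)$, the product over monic irreducible $Q\in\mathbb{F}_q[X]$ not dividing $G$. -}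

module Defs where

open import Level using (Level; _⊔_) renaming (suc to lsuc; zero to 0ℓ)
open import Data.Nat using (ℕ; zero; suc; _∸_; _≤_; _<_; _≟_; _≡ᵇ_; NonZero; _/_)
  renaming (_*_ to _*ℕ_)
open import Data.Nat.GCD using (gcd; gcd-zeroˡ)
open import Data.Bool using (if_then_else_)
open import Data.List using (List; []; _∷_; [_]; _++_; foldr; map; length; filter; applyUpTo; upTo; concatMap)
open import Data.List.Properties using (filter-accept)
open import Data.List.Membership.Propositional using (_∈_)
open import Data.List.Relation.Unary.Unique.Propositional using (Unique)
open import Data.Vec using (Vec; toList)
open import Data.Product using (Σ; ∃; _×_; _,_)
open import Data.Sum using (_⊎_)
open import Relation.Nullary using (¬_; Dec; ¬?)
open import Relation.Binary.PropositionalEquality using (_≡_; _≢_; refl)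
open import Function.Bundles using (_⇔_)
open import Algebra.Bundles using (CommutativeRing)
open import Algebra.Structures using (IsCommutativeRing)

coprimeIdx : ℕ → List ℕ
coprimeIdx s = filter (λ i → gcd i s ≟ 1) (applyUpTo suc s)

φ : ℕ → ℕ
φ n = length (coprimeIdx n)

φ-nonZero : ∀ n → .{{NonZero n}} → NonZero (φ n)
φ-nonZero (suc m) rewrite filter-accept (λ i → gcd i (suc m) ≟ 1) {x = 1}
  {xs = applyUpTo (λ i → suc (suc i)) m} (gcd-zeroˡ (suc m)) = _

-- φ(r)/φ(s) (an exact quotient when s ∣ r)
ratio : (r s : ℕ) → .{{NonZero s}} → ℕ
ratio r s = _/_ (φ r) (φ s) {{φ-nonZero s}}

tuples : ℕ → ℕ → List (List ℕ)
tuples s zero = [ [] ]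
tuples s (suc a) = concatMap (λ i → map (i ∷_) (tuples s a)) (coprimeIdx s)

record FiniteField : Set₁ where
  infixl 7 _*_
  infixl 6 _+_
  field
    Carrier : Set
    _+_ _*_ : Carrier → Carrier → Carrier
    -_ : Carrier → Carrier
    0# 1# : Carrier
    isCommutativeRing : IsCommutativeRing _≡_ _+_ _*_ -_ 0# 1#
    0≢1 : 0# ≢ 1#
    inverse : ∀ x → x ≢ 0# → ∃ λ y → x * y ≡ 1#
    elements : List Carrier
    complete : ∀ x → x ∈ elements

-- Polynomials over a finite field: coefficient lists, lowest degree first

module Poly (F : FiniteField) where
  open FiniteField F

  PolyF : Set
  PolyF = List Carrier

  coeff : PolyF → ℕ → Carrier
  coeff [] _ = 0#
  coeff (a ∷ p) zero = a
  coeff (a ∷ p) (suc i) = coeff p i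

  -- equality of polynomials (ignoring trailing zeros)
  _≈ₚ_ : PolyF → PolyF → Set
  p ≈ₚ q = ∀ i → coeff p i ≡ coeff q i

  addP : PolyF → PolyF → PolyF
  addP [] q = q
  addP p [] = p
  addP (a ∷ p) (b ∷ q) = (a + b) ∷ addP p q

  scaleP : Carrier → PolyF → PolyF
  scaleP c = map (c *_)

  mulP : PolyF → PolyF → PolyF
  mulP [] q = []
  mulP (a ∷ p) q = addP (scaleP a q) (0# ∷ mulP p q)

  oneP : PolyF
  oneP = [ 1# ]

  -- monic polynomial of degree k: X^k + c_{k-1}X^{k-1} + … + c_0
  Monic : ℕ → Set
  Monic k = Vec Carrier k

  toPoly : ∀ {k} → Monic k → PolyF
  toPoly c = toList c ++ [ 1# ]

  _∣ₚ_ : PolyF → PolyF → Set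
  A ∣ₚ B = ∃ λ C → mulP A C ≈ₚ B

  IsUnit : PolyF → Set
  IsUnit A = ∃ λ c → c ≢ 0# × A ≈ₚ [ c ]

  Irreducible : ∀ {k} → Monic k → Set
  Irreducible {k} Q = 1 ≤ k × (∀ A B → mulP A B ≈ₚ toPoly Q → IsUnit A ⊎ IsUnit B)

  IsIrrEnum : ((k : ℕ) → List (Monic k)) → Set
  IsIrrEnum irr = (∀ k (Q : Monic k) → (Q ∈ irr k) ⇔ Irreducible Q) × (∀ k → Unique (irr k))

  DivDecider : PolyF → Set
  DivDecider G = ∀ k (Q : Monic k) → Dec (toPoly Q ∣ₚ G)

module Series {c ℓ} (R : CommutativeRing c ℓ) where
  open CommutativeRing R

  sumR : List Carrier → Carrier
  sumR = foldr _+_ 0#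

  pow : Carrier → ℕ → Carrier
  pow x zero = 1#
  pow x (suc n) = x * pow x n

  fromℕ : ℕ → Carrier
  fromℕ zero = 0#
  fromℕ (suc n) = 1# + fromℕ n

  IsPrimitiveRoot : ℕ → Carrier → Set ℓ
  IsPrimitiveRoot s ξ = (pow ξ s ≈ 1#) × (∀ k → 0 < k → k < s → ¬ (pow ξ k ≈ 1#))

  Ser : Set c
  Ser = ℕ → Carrier

  oneS : Ser
  oneS n = if n ≡ᵇ 0 then 1# else 0#

  mulS : Ser → Ser → Ser
  mulS f g n = sumR (map (λ i → f i * g (n ∸ i)) (upTo (suc n)))

  prodS : List Ser → Ser
  prodS = foldr mulS oneS

  factorS : ℕ → Carrier → Ser
  factorS k a n = oneS n + (if n ≡ᵇ k then a else 0#)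

  rootSum : ℕ → Carrier → ℕ → Carrier
  rootSum s ξ k = sumR (map (λ i → pow ξ (i *ℕ k)) (coprimeIdx s))

-- [u^d] H_{r;s}(u;G).  Factors with deg Q > d do not affect the
-- coefficient of u^d (each is 1 + O(u^{d+1})), so the infinite product
-- is truncated to the monic irreducibles of degree 1..d.

Hcoeff : ∀ {c ℓ} (R : CommutativeRing c ℓ) (F : FiniteField)
         (irr : (k : ℕ) → List (Poly.Monic F k))
         (r s : ℕ) → .{{NonZero s}} → CommutativeRing.Carrier R →
         (G : Poly.PolyF F) → Poly.DivDecider F G → ℕ → CommutativeRing.Carrier R
Hcoeff R F irr r s ξ G dec d =
  prodS (concatMap (λ k → map (λ Q → factorS k (fromℕ (ratio r s) * rootSum s ξ k))
                               (filter (λ Q → ¬? (dec k Q)) (irr k)))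
                   (applyUpTo suc d)) d
  where
    open CommutativeRing R
    open Series R

module Submission where

-- Write c_k = (φ(r)/φ(s)) Σ_{(i,s)=1} ξ^{ik}.  Truncated at degree d,
-- H(u;G) is the product of the series 1 + c_k u^k, one for every monic
-- irreducible Q ∤ G of degree k ≤ d.  Every such Q satisfies Q ∤ 1, while
-- Q ∣ P only for Q = P; so the factor lists of H(u;1) and H(u;P) agree
-- except for one extra copy of 1 + c_n u^n, whence, coefficientwise,
-- H(u;1) = (1 + c_n u^n) H(u;P).  Inverting that factor gives the telescoping
-- identity  [u^d] H(u;P) = Σ_a (-c_n)^a [u^{d-an}] H(u;1),  and finally
-- (-φ(r)/φ(s))^a Σ_{i_1..i_a} ξ^{n(i_1+…+i_a)} = (-c_n)^a.

open import Defs
open import Data.Nat using (ℕ; suc; _∸_; _≤_; NonZero; _/_) renaming (_*_ to _*ℕ_)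
open import Data.Nat.Divisibility using (_∣_)
open import Data.Nat.ListAction using (sum)
open import Data.List using (List; map; upTo)
open import Algebra.Bundles using (CommutativeRing)

open import Data.Nat using (zero; _<_; _≤?_; _≡ᵇ_; z≤n; s≤s) renaming (_+_ to _+ℕ_)
import Data.Nat.Properties as ℕₚ
open import Data.Nat.DivMod using (m<n⇒m/n≡0; m/n≡0⇒m<n; m/n≡1+[m∸n]/n)
open import Data.Bool using (true; false; if_then_else_)
open import Data.List using ([]; _∷_; [_]; _++_; length; filter; applyUpTo; replicate; concatMap)
open import Data.List.Properties
  using (filter-all; filter-reject; map-concatMap; concatMap-cong; concatMap-++;
         map-replicate; map-applyUpTo; map-upTo; map-++; map-∘)
open import Data.List.Membership.Propositional using (_∈_)
open import Data.List.Relation.Unary.Any using (here; there)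
open import Data.List.Relation.Unary.All as All using (All; []; _∷_)
open import Data.List.Relation.Unary.All.Properties using (applyUpTo⁺₁; replicate⁺; concat⁺; map⁺)
open import Data.List.Relation.Unary.AllPairs using (_∷_)
open import Data.List.Relation.Unary.Unique.Propositional using (Unique)
open import Data.Vec using ([]; _∷_; toList)
open import Data.Product using (∃; _×_; _,_; proj₁; proj₂; uncurry)
open import Data.Sum using (inj₁; inj₂)
open import Data.Empty using (⊥-elim)
open import Relation.Binary.Definitions using (tri<; tri≈; tri>)
open import Relation.Nullary using (¬_; Dec; yes; no; ¬?; contradiction)
open import Relation.Binary.PropositionalEquality as P using (_≡_; _≢_)
open import Function.Bundles using (Equivalence)
open import Algebra.Structures using (IsCommutativeRing)
import Relation.Binary.Reasoning.Setoid as SetoidReasoning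
import Algebra.Properties.Ring as RingProperties
import Algebra.Properties.CommutativeSemigroup as CommutativeSemigroupProperties
import Algebra.Properties.CommutativeSemiring.Exp as Exponentiation

length-reject-unique : ∀ {A : Set} {R : A → Set} (R? : ∀ y → Dec (R y)) {x : A} (xs : List A) →
  Unique xs → x ∈ xs → R x → (∀ y → y ∈ xs → R y → y ≡ x) →
  length xs ≡ suc (length (filter (λ y → ¬? (R? y)) xs))
length-reject-unique {R = R} R? (y ∷ ys) (y∉ys ∷ _) (here x≡y) Rx only
  rewrite filter-reject (λ z → ¬? (R? z)) {x = y} {xs = ys} (λ ¬Ry → ¬Ry (P.subst R x≡y Rx))
        | filter-all (λ z → ¬? (R? z)) {xs = ys}
            (All.tabulate (λ z∈ys Rz → All.lookup y∉ys z∈ys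
              (P.trans (P.sym x≡y) (P.sym (only _ (there z∈ys) Rz)))))
  = P.refl
length-reject-unique {R = R} R? (y ∷ ys) (y∉ys ∷ unique) (there x∈ys) Rx only with R? y
... | yes Ry = ⊥-elim (All.lookup y∉ys x∈ys (only y (here P.refl) Ry))
... | no ¬Ry = P.cong suc (length-reject-unique R? ys unique x∈ys Rx (λ z z∈ys → only z (there z∈ys)))

applyUpTo-++ : ∀ {a} {A : Set a} (f : ℕ → A) m e →
  applyUpTo f (m +ℕ e) ≡ applyUpTo f m ++ applyUpTo (λ i → f (m +ℕ i)) e
applyUpTo-++ f zero e = P.refl
applyUpTo-++ f (suc m) e = P.cong (f 0 ∷_) (applyUpTo-++ (λ i → f (suc i)) m e)

applyUpTo-split : ∀ {a} {A : Set a} (f : ℕ → A) m e →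
  applyUpTo f (m +ℕ suc e) ≡ applyUpTo f m ++ f m ∷ applyUpTo (λ i → f (suc (m +ℕ i))) e
applyUpTo-split f zero e = P.refl
applyUpTo-split f (suc m) e = P.cong (f 0 ∷_) (applyUpTo-split (λ i → f (suc i)) m e)

map-const : ∀ {a b} {A : Set a} {B : Set b} (y : B) (xs : List A) → map (λ _ → y) xs ≡ replicate (length xs) y
map-const y [] = P.refl
map-const y (x ∷ xs) = P.cong (y ∷_) (map-const y xs)

-- Monic polynomials over a finite field

module MonicPolynomials (F : FiniteField) where
  open FiniteField F
  open Poly F
  open IsCommutativeRing isCommutativeRing
    using (+-identityˡ; +-identityʳ; *-identityˡ; *-identityʳ; zeroˡ; zeroʳ)
  open P.≡-Reasoning

  coeff-addP : ∀ p q i → coeff (addP p q) i ≡ coeff p i + coeff q i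
  coeff-addP [] q i = P.sym (+-identityˡ _)
  coeff-addP (a ∷ p) [] i = P.sym (+-identityʳ _)
  coeff-addP (a ∷ p) (b ∷ q) zero = P.refl
  coeff-addP (a ∷ p) (b ∷ q) (suc i) = coeff-addP p q i

  coeff-scaleP : ∀ a q i → coeff (scaleP a q) i ≡ a * coeff q i
  coeff-scaleP a [] i = P.sym (zeroʳ a)
  coeff-scaleP a (b ∷ q) zero = P.refl
  coeff-scaleP a (b ∷ q) (suc i) = coeff-scaleP a q i

  coeff-mulP-zero : ∀ x p C → coeff (mulP (x ∷ p) C) 0 ≡ x * coeff C 0 + 0#
  coeff-mulP-zero x p C =
    P.trans (coeff-addP (scaleP x C) (0# ∷ mulP p C) 0) (P.cong (_+ 0#) (coeff-scaleP x C 0))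

  coeff-mulP-suc : ∀ x p C i → coeff (mulP (x ∷ p) C) (suc i) ≡ x * coeff C (suc i) + coeff (mulP p C) i
  coeff-mulP-suc x p C i =
    P.trans (coeff-addP (scaleP x C) (0# ∷ mulP p C) (suc i))
            (P.cong (_+ coeff (mulP p C) i) (coeff-scaleP x C (suc i)))

  coeff-beyond : ∀ p i → length p ≤ i → coeff p i ≡ 0#
  coeff-beyond [] i _ = P.refl
  coeff-beyond (x ∷ p) (suc i) (s≤s le) = coeff-beyond p i le

  coeff-mulP-const : ∀ A B c → B ≈ₚ [ c ] → ∀ i → coeff (mulP A B) i ≡ coeff A i * c
  coeff-mulP-const [] B c B≈c i = P.sym (zeroˡ c)
  coeff-mulP-const (a ∷ p) B c B≈c zero =
    P.trans (coeff-mulP-zero a p B) (P.trans (+-identityʳ _) (P.cong (a *_) (B≈c 0)))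
  coeff-mulP-const (a ∷ p) B c B≈c (suc i) = begin
      coeff (mulP (a ∷ p) B) (suc i)                ≡⟨ coeff-mulP-suc a p B i ⟩
      a * coeff B (suc i) + coeff (mulP p B) i      ≡⟨ P.cong₂ _+_ (P.cong (a *_) (B≈c (suc i)))
                                                                  (coeff-mulP-const p B c B≈c i) ⟩
      a * 0# + coeff p i * c                        ≡⟨ P.cong (_+ coeff p i * c) (zeroʳ a) ⟩
      0# + coeff p i * c                            ≡⟨ +-identityˡ _ ⟩
      coeff p i * c                                 ∎

  coeff-mulP-monic : ∀ xs B m → (∀ j → m < j → coeff B j ≡ 0#) →
    coeff (mulP (xs ++ [ 1# ]) B) (length xs +ℕ m) ≡ coeff B m
  coeff-mulP-monic [] B m _ = begin
      coeff (addP (scaleP 1# B) [ 0# ]) m        ≡⟨ coeff-addP (scaleP 1# B) [ 0# ] m ⟩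
      coeff (scaleP 1# B) m + coeff [ 0# ] m     ≡⟨ P.cong₂ _+_ (coeff-scaleP 1# B m) (zero-poly m) ⟩
      1# * coeff B m + 0#                        ≡⟨ P.trans (+-identityʳ _) (*-identityˡ _) ⟩
      coeff B m                                  ∎
    where
      zero-poly : ∀ i → coeff [ 0# ] i ≡ 0#
      zero-poly zero = P.refl
      zero-poly (suc i) = P.refl
  coeff-mulP-monic (x ∷ xs) B m B≤m = begin
      coeff (mulP (x ∷ (xs ++ [ 1# ])) B) (suc (length xs +ℕ m))
    ≡⟨ coeff-mulP-suc x (xs ++ [ 1# ]) B (length xs +ℕ m) ⟩
      x * coeff B (suc (length xs +ℕ m)) + coeff (mulP (xs ++ [ 1# ]) B) (length xs +ℕ m)
    ≡⟨ P.cong₂ _+_ (P.cong (x *_) (B≤m _ (s≤s (ℕₚ.m≤n+m m (length xs)))))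
                   (coeff-mulP-monic xs B m B≤m) ⟩
      x * 0# + coeff B m
    ≡⟨ P.trans (P.cong (_+ coeff B m) (zeroʳ x)) (+-identityˡ _) ⟩
      coeff B m
    ∎

  coeff-top : ∀ {k} (Q : Monic k) → coeff (toPoly Q) k ≡ 1#
  coeff-top [] = P.refl
  coeff-top (q ∷ Q) = coeff-top Q

  coeff-above : ∀ {k} (Q : Monic k) i → k < i → coeff (toPoly Q) i ≡ 0#
  coeff-above [] (suc i) _ = P.refl
  coeff-above (q ∷ Q) (suc i) (s≤s k<i) = coeff-above Q i k<i

  -- A monic polynomial of positive degree does not divide 1: if Q·C = 1 then
  -- downward induction on the degree shows C = 0, so 1 = (Q·C)₀ = 0.
  monic-∤-one : ∀ {k} (Q : Monic k) → 1 ≤ k → ¬ (toPoly Q ∣ₚ oneP)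
  monic-∤-one (q ∷ Q) _ (C , QC≈1) = 0≢1 (P.sym (begin
      1#                                   ≡⟨ P.sym (QC≈1 0) ⟩
      coeff (mulP (toPoly (q ∷ Q)) C) 0    ≡⟨ coeff-mulP-zero q (toPoly Q) C ⟩
      q * coeff C 0 + 0#                   ≡⟨ P.cong (λ z → q * z + 0#) (C-vanishes (length C) 0 (ℕₚ.m≤m+n _ 0)) ⟩
      q * 0# + 0#                          ≡⟨ P.trans (+-identityʳ _) (zeroʳ q) ⟩
      0#                                   ∎))
    where
      C-vanishes : ∀ t j → length C ≤ t +ℕ j → coeff C j ≡ 0#
      C-vanishes zero j le = coeff-beyond C j le
      C-vanishes (suc t) j le = begin
          coeff C j
        ≡⟨ P.sym (coeff-mulP-monic (toList (q ∷ Q)) C j (λ j′ j<j′ → C-vanishes t j′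
             (ℕₚ.≤-trans le (ℕₚ.≤-trans (ℕₚ.≤-reflexive (P.sym (ℕₚ.+-suc t j))) (ℕₚ.+-monoʳ-≤ t j<j′))))) ⟩
          coeff (mulP (toPoly (q ∷ Q)) C) (suc (length (toList Q)) +ℕ j)
        ≡⟨ QC≈1 _ ⟩
          0#
        ∎

  -- A monic divisor of positive degree of an irreducible P is P up to a
  -- nonzero constant, since the cofactor must be the unit.
  divisor-is-multiple : ∀ {k n} (Q : Monic k) (P : Monic n) → 1 ≤ k → Irreducible P →
    toPoly Q ∣ₚ toPoly P → ∃ λ c → c ≢ 0# × (∀ i → coeff (toPoly P) i ≡ coeff (toPoly Q) i * c)
  divisor-is-multiple {suc k} Q P _ (_ , factorisations) (C , QC≈P) with factorisations (toPoly Q) C QC≈P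
  ... | inj₁ (c , _ , Q≈c) = ⊥-elim (0≢1 (P.sym (P.trans (P.sym (coeff-top Q)) (Q≈c (suc k)))))
  ... | inj₂ (c , c≢0 , C≈c) = c , c≢0 , λ i → P.trans (P.sym (QC≈P i)) (coeff-mulP-const (toPoly Q) C c C≈c i)

  multiple-degree : ∀ {k n} (Q : Monic k) (P : Monic n) c → c ≢ 0# →
    (∀ i → coeff (toPoly P) i ≡ coeff (toPoly Q) i * c) → k ≡ n
  multiple-degree {k} {n} Q P c c≢0 P≈Qc with ℕₚ.<-cmp k n
  ... | tri≈ _ k≡n _ = k≡n
  ... | tri< k<n _ _ = ⊥-elim (0≢1 (P.sym (begin
      1#                          ≡⟨ P.sym (coeff-top P) ⟩
      coeff (toPoly P) n          ≡⟨ P≈Qc n ⟩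
      coeff (toPoly Q) n * c      ≡⟨ P.cong (_* c) (coeff-above Q n k<n) ⟩
      0# * c                      ≡⟨ zeroˡ c ⟩
      0#                          ∎)))
  ... | tri> _ _ n<k = ⊥-elim (c≢0 (P.sym (begin
      0#                          ≡⟨ P.sym (coeff-above P k n<k) ⟩
      coeff (toPoly P) k          ≡⟨ P≈Qc k ⟩
      coeff (toPoly Q) k * c      ≡⟨ P.cong (_* c) (coeff-top Q) ⟩
      1# * c                      ≡⟨ *-identityˡ c ⟩
      c                           ∎)))

  multiple-equal : ∀ {n} (Q P : Monic n) c → (∀ i → coeff (toPoly P) i ≡ coeff (toPoly Q) i * c) → Q ≡ P
  multiple-equal {n} Q P c P≈Qc = same-coefficients Q P (λ i →
      P.sym (P.trans (P≈Qc i) (P.trans (P.cong (coeff (toPoly Q) i *_) c≡1) (*-identityʳ _))))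
    where
      c≡1 : c ≡ 1#
      c≡1 = P.sym (P.trans (P.sym (coeff-top P))
                   (P.trans (P≈Qc n) (P.trans (P.cong (_* c) (coeff-top Q)) (*-identityˡ c))))
      same-coefficients : ∀ {m} (Q P : Monic m) → (∀ i → coeff (toPoly Q) i ≡ coeff (toPoly P) i) → Q ≡ P
      same-coefficients [] [] _ = P.refl
      same-coefficients (q ∷ Q) (p ∷ P) eq = P.cong₂ _∷_ (eq 0) (same-coefficients Q P (λ i → eq (suc i)))

  divides-self : ∀ {n} (P : Monic n) → toPoly P ∣ₚ toPoly P
  divides-self P = [ 1# ] , λ i → P.trans (coeff-mulP-const (toPoly P) [ 1# ] 1# (λ _ → P.refl) i) (*-identityʳ _)

-- Power series over a commutative ring

module PowerSeries {c ℓ} (R : CommutativeRing c ℓ) where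
  open CommutativeRing R
  open Series R
  open SetoidReasoning setoid
  open CommutativeSemigroupProperties +-commutativeSemigroup using (interchange)
  open Exponentiation commutativeSemiring using (_^_; ^-homo-*; ^-distrib-*; ^-congˡ)

  sumR-cong : ∀ {A : Set} {f g : A → Carrier} → (∀ x → f x ≈ g x) → ∀ xs → sumR (map f xs) ≈ sumR (map g xs)
  sumR-cong f≈g [] = refl
  sumR-cong f≈g (x ∷ xs) = +-cong (f≈g x) (sumR-cong f≈g xs)

  sumR-++ : ∀ xs ys → sumR (xs ++ ys) ≈ sumR xs + sumR ys
  sumR-++ [] ys = sym (+-identityˡ _)
  sumR-++ (x ∷ xs) ys = trans (+-congˡ (sumR-++ xs ys)) (sym (+-assoc _ _ _))

  sumR-+ : ∀ {A : Set} (f g : A → Carrier) xs →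
    sumR (map (λ x → f x + g x) xs) ≈ sumR (map f xs) + sumR (map g xs)
  sumR-+ f g [] = sym (+-identityˡ 0#)
  sumR-+ f g (x ∷ xs) = trans (+-congˡ (sumR-+ f g xs)) (interchange _ _ _ _)

  sumR-*ˡ : ∀ {A : Set} k (f : A → Carrier) xs → sumR (map (λ x → k * f x) xs) ≈ k * sumR (map f xs)
  sumR-*ˡ k f [] = sym (zeroʳ k)
  sumR-*ˡ k f (x ∷ xs) = trans (+-congˡ (sumR-*ˡ k f xs)) (sym (distribˡ k _ _))

  sumR-*ʳ : ∀ {A : Set} k (f : A → Carrier) xs → sumR (map (λ x → f x * k) xs) ≈ sumR (map f xs) * k
  sumR-*ʳ k f [] = sym (zeroˡ k)
  sumR-*ʳ k f (x ∷ xs) = trans (+-congˡ (sumR-*ʳ k f xs)) (sym (distribʳ k _ _))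

  sumR-concatMap : ∀ {A B : Set} (f : B → Carrier) (g : A → List B) xs →
    sumR (map f (concatMap g xs)) ≈ sumR (map (λ x → sumR (map f (g x))) xs)
  sumR-concatMap f g [] = refl
  sumR-concatMap f g (x ∷ xs) = begin
      sumR (map f (g x ++ concatMap g xs))               ≡⟨ P.cong sumR (map-++ f (g x) (concatMap g xs)) ⟩
      sumR (map f (g x) ++ map f (concatMap g xs))       ≈⟨ sumR-++ (map f (g x)) _ ⟩
      sumR (map f (g x)) + sumR (map f (concatMap g xs)) ≈⟨ +-congˡ (sumR-concatMap f g xs) ⟩
      sumR (map f (g x)) + sumR (map (λ y → sumR (map f (g y))) xs) ∎

  sumR-upTo-suc : ∀ (f : ℕ → Carrier) k → sumR (map f (upTo (suc k))) ≡ f 0 + sumR (map (λ a → f (suc a)) (upTo k))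
  sumR-upTo-suc f k = P.cong (λ xs → f 0 + sumR xs)
    (P.trans (map-applyUpTo suc f k) (P.sym (map-upTo (λ a → f (suc a)) k)))

  sumR-zero : ∀ len (f : ℕ → Carrier) → (∀ i → i < len → f i ≈ 0#) → sumR (applyUpTo f len) ≈ 0#
  sumR-zero zero f _ = refl
  sumR-zero (suc len) f f≈0 =
    trans (+-cong (f≈0 0 (s≤s z≤n)) (sumR-zero len (λ i → f (suc i)) (λ i i<len → f≈0 (suc i) (s≤s i<len))))
          (+-identityˡ 0#)

  sumR-single : ∀ len t (f : ℕ → Carrier) → t < len → (∀ i → i ≢ t → f i ≈ 0#) → sumR (applyUpTo f len) ≈ f t
  sumR-single (suc len) zero f _ f≈0 =
    trans (+-congˡ (sumR-zero len (λ i → f (suc i)) (λ i _ → f≈0 (suc i) (λ ())))) (+-identityʳ _)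
  sumR-single (suc len) (suc t) f (s≤s t<len) f≈0 =
    trans (+-cong (f≈0 0 (λ ()))
                  (sumR-single len t (λ i → f (suc i)) t<len (λ i i≢t → f≈0 (suc i) (λ eq → i≢t (ℕₚ.suc-injective eq)))))
          (+-identityˡ _)

  pow-^ : ∀ x k → pow x k ≡ x ^ k
  pow-^ x zero = P.refl
  pow-^ x (suc k) = P.cong (x *_) (pow-^ x k)

  pow-cong : ∀ {x y} k → x ≈ y → pow x k ≈ pow y k
  pow-cong {x} {y} k x≈y = begin
    pow x k  ≡⟨ pow-^ x k ⟩  x ^ k  ≈⟨ ^-congˡ k x≈y ⟩  y ^ k  ≡⟨ P.sym (pow-^ y k) ⟩  pow y k  ∎

  pow-+ : ∀ x i j → pow x (i +ℕ j) ≈ pow x i * pow x j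
  pow-+ x i j = begin
    pow x (i +ℕ j)      ≡⟨ pow-^ x (i +ℕ j) ⟩
    x ^ (i +ℕ j)        ≈⟨ ^-homo-* x i j ⟩
    x ^ i * x ^ j       ≡⟨ P.sym (P.cong₂ _*_ (pow-^ x i) (pow-^ x j)) ⟩
    pow x i * pow x j   ∎

  pow-* : ∀ x y k → pow (x * y) k ≈ pow x k * pow y k
  pow-* x y k = begin
    pow (x * y) k       ≡⟨ pow-^ (x * y) k ⟩
    (x * y) ^ k         ≈⟨ ^-distrib-* x y k ⟩
    x ^ k * y ^ k       ≡⟨ P.sym (P.cong₂ _*_ (pow-^ x k) (pow-^ y k)) ⟩
    pow x k * pow y k   ∎

  tuples-sum : ∀ s n ξ a → sumR (map (λ is → pow ξ (n *ℕ sum is)) (tuples s a)) ≈ pow (rootSum s ξ n) a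
  tuples-sum s n ξ zero = trans (+-identityʳ _) (reflexive (P.cong (pow ξ) (ℕₚ.*-zeroʳ n)))
  tuples-sum s n ξ (suc a) = begin
      sumR (map weight (concatMap (λ i → map (i ∷_) (tuples s a)) (coprimeIdx s)))
    ≈⟨ sumR-concatMap weight (λ i → map (i ∷_) (tuples s a)) (coprimeIdx s) ⟩
      sumR (map (λ i → sumR (map weight (map (i ∷_) (tuples s a)))) (coprimeIdx s))
    ≈⟨ sumR-cong extend (coprimeIdx s) ⟩
      sumR (map (λ i → pow ξ (i *ℕ n) * T) (coprimeIdx s))
    ≈⟨ sumR-*ʳ T (λ i → pow ξ (i *ℕ n)) (coprimeIdx s) ⟩
      rootSum s ξ n * T
    ≈⟨ *-congˡ (tuples-sum s n ξ a) ⟩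
      rootSum s ξ n * pow (rootSum s ξ n) a
    ∎
    where
      weight : List ℕ → Carrier
      weight is = pow ξ (n *ℕ sum is)
      T : Carrier
      T = sumR (map weight (tuples s a))
      extend : ∀ i → sumR (map weight (map (i ∷_) (tuples s a))) ≈ pow ξ (i *ℕ n) * T
      extend i = begin
          sumR (map weight (map (i ∷_) (tuples s a)))
        ≡⟨ P.cong sumR (P.sym (map-∘ (tuples s a))) ⟩
          sumR (map (λ is → weight (i ∷ is)) (tuples s a))
        ≈⟨ sumR-cong (λ is → trans (reflexive (P.cong (pow ξ)
               (P.trans (ℕₚ.*-distribˡ-+ n i (sum is)) (P.cong (_+ℕ n *ℕ sum is) (ℕₚ.*-comm n i)))))
               (pow-+ ξ (i *ℕ n) (n *ℕ sum is))) (tuples s a) ⟩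
          sumR (map (λ is → pow ξ (i *ℕ n) * weight is) (tuples s a))
        ≈⟨ sumR-*ˡ (pow ξ (i *ℕ n)) weight (tuples s a) ⟩
          pow ξ (i *ℕ n) * T
        ∎

  -- the coefficient function of the monomial a·u^k; note oneS = monomial 0 1#
  -- and factorS k a i = oneS i + monomial k a i
  monomial : ℕ → Carrier → ℕ → Carrier
  monomial k a i = if i ≡ᵇ k then a else 0#

  monomial-at : ∀ a k → monomial k a k ≡ a
  monomial-at a k with k ≡ᵇ k | ℕₚ.≡⇒≡ᵇ k k P.refl
  ... | true | _ = P.refl

  monomial-off : ∀ a {k i} → i ≢ k → monomial k a i ≡ 0#
  monomial-off a {k} {i} i≢k with i ≡ᵇ k | ℕₚ.≡ᵇ⇒≡ i k
  ... | true | to≡ = contradiction (to≡ _) i≢k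
  ... | false | _ = P.refl

  shift : ℕ → Ser → Ser
  shift k g m with k ≤? m
  ... | yes _ = g (m ∸ k)
  ... | no _ = 0#

  shift-≤ : ∀ {k m} g → k ≤ m → shift k g m ≡ g (m ∸ k)
  shift-≤ {k} {m} g k≤m with k ≤? m
  ... | yes _ = P.refl
  ... | no k≰m = contradiction k≤m k≰m

  shift-≰ : ∀ {k m} g → ¬ k ≤ m → shift k g m ≡ 0#
  shift-≰ {k} {m} g k≰m with k ≤? m
  ... | yes k≤m = contradiction k≤m k≰m
  ... | no _ = P.refl

  shift-shift : ∀ k n g m → shift k (shift n g) m ≡ shift (k +ℕ n) g m
  shift-shift k n g m with k ≤? m
  ... | no k≰m = P.sym (shift-≰ g (λ k+n≤m → k≰m (ℕₚ.≤-trans (ℕₚ.m≤m+n k n) k+n≤m)))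
  ... | yes k≤m with n ≤? m ∸ k
  ...   | yes n≤m∸k = P.sym (P.trans (shift-≤ g (P.subst (_≤ m) (ℕₚ.+-comm n k) (ℕₚ.m≤o∸n⇒m+n≤o n k≤m n≤m∸k)))
                                    (P.cong g (P.sym (ℕₚ.∸-+-assoc m k n))))
  ...   | no n≰m∸k = P.sym (shift-≰ g (λ k+n≤m → n≰m∸k
                        (ℕₚ.m+n≤o⇒m≤o∸n n (P.subst (_≤ m) (ℕₚ.+-comm k n) k+n≤m))))

  shift-linear : ∀ k m b (M Y Z : Ser) → (∀ j → M j ≈ Y j + b * Z j) →
    shift k M m ≈ shift k Y m + b * shift k Z m
  shift-linear k m b M Y Z M≈ with k ≤? m
  ... | yes _ = M≈ (m ∸ k)
  ... | no _ = sym (trans (+-identityˡ _) (zeroʳ b))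

  as-range : ∀ k a (g : Ser) m → sumR (map (λ i → monomial k a i * g (m ∸ i)) (upTo (suc m)))
                         ≡ sumR (applyUpTo (λ i → monomial k a i * g (m ∸ i)) (suc m))
  as-range k a g m = P.cong sumR (map-upTo (λ i → monomial k a i * g (m ∸ i)) (suc m))

  monomial-conv : ∀ k a g m → sumR (map (λ i → monomial k a i * g (m ∸ i)) (upTo (suc m))) ≈ a * shift k g m
  monomial-conv k a g m with k ≤? m
  ... | yes k≤m = trans (reflexive (as-range k a g m))
                    (trans (sumR-single (suc m) k (λ i → monomial k a i * g (m ∸ i)) (s≤s k≤m)
                             (λ i i≢k → trans (*-congʳ (reflexive (monomial-off a i≢k))) (zeroˡ _)))
                           (*-congʳ (reflexive (monomial-at a k))))
  ... | no k≰m = trans (reflexive (as-range k a g m))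
                   (trans (sumR-zero (suc m) (λ i → monomial k a i * g (m ∸ i)) (λ i i≤m →
                             trans (*-congʳ (reflexive (monomial-off a {k} {i} (λ { P.refl → k≰m (ℕₚ.≤-pred i≤m) }))))
                                   (zeroˡ _)))
                          (sym (zeroʳ a)))

  factor-mul : ∀ k a g m → mulS (factorS k a) g m ≈ g m + a * shift k g m
  factor-mul k a g m = begin
      sumR (map (λ i → factorS k a i * g (m ∸ i)) (upTo (suc m)))
    ≈⟨ sumR-cong (λ i → distribʳ (g (m ∸ i)) (monomial 0 1# i) (monomial k a i)) (upTo (suc m)) ⟩
      sumR (map (λ i → monomial 0 1# i * g (m ∸ i) + monomial k a i * g (m ∸ i)) (upTo (suc m)))
    ≈⟨ sumR-+ (λ i → monomial 0 1# i * g (m ∸ i)) (λ i → monomial k a i * g (m ∸ i)) (upTo (suc m)) ⟩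
      sumR (map (λ i → monomial 0 1# i * g (m ∸ i)) (upTo (suc m)))
        + sumR (map (λ i → monomial k a i * g (m ∸ i)) (upTo (suc m)))
    ≈⟨ +-cong (monomial-conv 0 1# g m) (monomial-conv k a g m) ⟩
      1# * shift 0 g m + a * shift k g m
    ≈⟨ +-congʳ (trans (*-identityˡ _) (reflexive (shift-≤ g z≤n))) ⟩
      g m + a * shift k g m
    ∎

  factor-mul-low : ∀ k a g m → m < k → mulS (factorS k a) g m ≈ g m
  factor-mul-low k a g m m<k = begin
      mulS (factorS k a) g m   ≈⟨ factor-mul k a g m ⟩
      g m + a * shift k g m    ≡⟨ P.cong (λ z → g m + a * z) (shift-≰ g (ℕₚ.<⇒≱ m<k)) ⟩
      g m + a * 0#             ≈⟨ trans (+-congˡ (zeroʳ a)) (+-identityʳ _) ⟩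
      g m                      ∎

  factor-cancel : ∀ k a g m → mulS (factorS k a) g m + (- a) * shift k g m ≈ g m
  factor-cancel k a g m = begin
      mulS (factorS k a) g m + (- a) * shift k g m
    ≈⟨ +-congʳ (factor-mul k a g m) ⟩
      (g m + a * shift k g m) + (- a) * shift k g m
    ≈⟨ +-assoc _ _ _ ⟩
      g m + (a * shift k g m + (- a) * shift k g m)
    ≈⟨ +-congˡ (trans (sym (distribʳ _ a (- a))) (trans (*-congʳ (-‿inverseʳ a)) (zeroˡ _))) ⟩
      g m + 0#
    ≈⟨ +-identityʳ _ ⟩
      g m
    ∎

  mulS-congʳ-upto : ∀ f g h m → (∀ j → j ≤ m → g j ≈ h j) → ∀ j → j ≤ m → mulS f g j ≈ mulS f h j
  mulS-congʳ-upto f g h m g≈h j j≤m =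
    sumR-cong (λ i → *-congˡ (g≈h (j ∸ i) (ℕₚ.≤-trans (ℕₚ.m∸n≤m j i) j≤m))) (upTo (suc j))

  factor-expand : ∀ k a n b Y m → mulS (factorS k a) (mulS (factorS n b) Y) m
    ≈ (Y m + b * shift n Y m) + (a * shift k Y m + (a * b) * shift (k +ℕ n) Y m)
  factor-expand k a n b Y m = begin
      mulS (factorS k a) M m
    ≈⟨ factor-mul k a M m ⟩
      M m + a * shift k M m
    ≈⟨ +-cong (factor-mul n b Y m) (*-congˡ (shift-linear k m b M Y (shift n Y) (factor-mul n b Y))) ⟩
      (Y m + b * shift n Y m) + a * (shift k Y m + b * shift k (shift n Y) m)
    ≈⟨ +-congˡ (trans (distribˡ a _ _) (+-congˡ (sym (*-assoc a b _)))) ⟩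
      (Y m + b * shift n Y m) + (a * shift k Y m + (a * b) * shift k (shift n Y) m)
    ≡⟨ P.cong (λ z → (Y m + b * shift n Y m) + (a * shift k Y m + (a * b) * z)) (shift-shift k n Y m) ⟩
      (Y m + b * shift n Y m) + (a * shift k Y m + (a * b) * shift (k +ℕ n) Y m)
    ∎
    where
      M : Ser
      M = mulS (factorS n b) Y

  factor-swap : ∀ k a n b Y m →
    mulS (factorS k a) (mulS (factorS n b) Y) m ≈ mulS (factorS n b) (mulS (factorS k a) Y) m
  factor-swap k a n b Y m = begin
      mulS (factorS k a) (mulS (factorS n b) Y) m
    ≈⟨ factor-expand k a n b Y m ⟩
      (Y m + b * shift n Y m) + (a * shift k Y m + (a * b) * shift (k +ℕ n) Y m)
    ≈⟨ interchange _ _ _ _ ⟩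
      (Y m + a * shift k Y m) + (b * shift n Y m + (a * b) * shift (k +ℕ n) Y m)
    ≈⟨ +-congˡ (+-congˡ (*-cong (*-comm a b) (reflexive (P.cong (λ i → shift i Y m) (ℕₚ.+-comm k n))))) ⟩
      (Y m + a * shift k Y m) + (b * shift n Y m + (b * a) * shift (n +ℕ k) Y m)
    ≈⟨ sym (factor-expand n b k a Y m) ⟩
      mulS (factorS n b) (mulS (factorS k a) Y) m
    ∎

  prodF : List (ℕ × Carrier) → Ser
  prodF fs = prodS (map (uncurry factorS) fs)

  prodF-extract : ∀ xs ys k a j → prodF (xs ++ (k , a) ∷ ys) j ≈ mulS (factorS k a) (prodF (xs ++ ys)) j
  prodF-extract [] ys k a j = refl
  prodF-extract ((k′ , a′) ∷ xs) ys k a j = begin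
      mulS (factorS k′ a′) (prodF (xs ++ (k , a) ∷ ys)) j
    ≈⟨ mulS-congʳ-upto (factorS k′ a′) _ _ j (λ i _ → prodF-extract xs ys k a i) j ℕₚ.≤-refl ⟩
      mulS (factorS k′ a′) (mulS (factorS k a) (prodF (xs ++ ys))) j
    ≈⟨ factor-swap k′ a′ k a (prodF (xs ++ ys)) j ⟩
      mulS (factorS k a) (mulS (factorS k′ a′) (prodF (xs ++ ys))) j
    ∎

  prodF-high : ∀ m ys → All (λ f → m < proj₁ f) ys → ∀ j → j ≤ m → prodF ys j ≈ oneS j
  prodF-high m [] [] j _ = refl
  prodF-high m ((k , a) ∷ ys) (m<k ∷ high) j j≤m =
    trans (factor-mul-low k a (prodF ys) j (ℕₚ.≤-<-trans j≤m m<k)) (prodF-high m ys high j j≤m)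

  prodF-truncate : ∀ m xs ys → All (λ f → m < proj₁ f) ys → ∀ j → j ≤ m → prodF (xs ++ ys) j ≈ prodF xs j
  prodF-truncate m [] ys high j j≤m = prodF-high m ys high j j≤m
  prodF-truncate m ((k , a) ∷ xs) ys high j j≤m =
    mulS-congʳ-upto (factorS k a) _ _ m (prodF-truncate m xs ys high) j j≤m

  factors : (ℕ → Carrier) → (ℕ → ℕ) → List ℕ → List (ℕ × Carrier)
  factors coef N ks = concatMap (λ k → replicate (N k) (k , coef k)) ks

  factors-cong : ∀ coef N M ks → All (λ k → N k ≡ M k) ks → factors coef N ks ≡ factors coef M ks
  factors-cong coef N M [] [] = P.refl
  factors-cong coef N M (k ∷ ks) (Nk≡Mk ∷ eqs) =
    P.cong₂ _++_ (P.cong (λ z → replicate z (k , coef k)) Nk≡Mk) (factors-cong coef N M ks eqs)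

  factors-All : ∀ {p} {Q : ℕ → Set p} coef N ks → All Q ks → All (λ f → Q (proj₁ f)) (factors coef N ks)
  factors-All coef N ks Qks = concat⁺ (map⁺ (All.map (replicate⁺ _) Qks))

  factors-truncate : ∀ coef N m d → m ≤ d → ∀ j → j ≤ m →
    prodF (factors coef N (applyUpTo suc d)) j ≈ prodF (factors coef N (applyUpTo suc m)) j
  factors-truncate coef N m d m≤d j j≤m = begin
      prodF (factors coef N (applyUpTo suc d)) j
    ≡⟨ P.cong (λ D → prodF (factors coef N (applyUpTo suc D)) j) (P.sym (ℕₚ.m+[n∸m]≡n m≤d)) ⟩
      prodF (factors coef N (applyUpTo suc (m +ℕ (d ∸ m)))) j
    ≡⟨ P.cong (λ ks → prodF ks j) (P.trans (P.cong (factors coef N) (applyUpTo-++ suc m (d ∸ m)))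
                                           (concatMap-++ _ (applyUpTo suc m) high)) ⟩
      prodF (factors coef N (applyUpTo suc m) ++ factors coef N high) j
    ≈⟨ prodF-truncate m (factors coef N (applyUpTo suc m)) (factors coef N high) (factors-All coef N high (applyUpTo⁺₁ _ _ (λ {i} _ → s≤s (ℕₚ.m≤m+n m i)))) j j≤m ⟩
      prodF (factors coef N (applyUpTo suc m)) j
    ∎
    where
      high : List ℕ
      high = applyUpTo (λ i → suc (m +ℕ i)) (d ∸ m)

  factors-extract : ∀ coef N M t pre post → All (λ k → N k ≡ M k) pre → All (λ k → N k ≡ M k) post →
    N t ≡ suc (M t) → ∀ j → prodF (factors coef N (pre ++ t ∷ post)) j
                           ≈ mulS (factorS t (coef t)) (prodF (factors coef M (pre ++ t ∷ post))) j
  factors-extract coef N M t pre post N≡M-pre N≡M-post Nt≡1+Mt j = begin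
      prodF (factors coef N (pre ++ t ∷ post)) j
    ≡⟨ P.cong (λ ks → prodF ks j) (concatMap-++ _ pre (t ∷ post)) ⟩
      prodF (factors coef N pre ++ replicate (N t) (t , coef t) ++ factors coef N post) j
    ≡⟨ P.cong (λ ks → prodF ks j) (P.cong₂ _++_ (factors-cong coef N M pre N≡M-pre)
         (P.cong₂ _++_ (P.cong (λ z → replicate z (t , coef t)) Nt≡1+Mt) (factors-cong coef N M post N≡M-post))) ⟩
      prodF (factors coef M pre ++ (t , coef t) ∷ (replicate (M t) (t , coef t) ++ factors coef M post)) j
    ≈⟨ prodF-extract (factors coef M pre) _ t (coef t) j ⟩
      mulS (factorS t (coef t)) (prodF (factors coef M pre ++ replicate (M t) (t , coef t) ++ factors coef M post)) j
    ≡⟨ P.cong (λ ks → mulS (factorS t (coef t)) (prodF ks) j) (P.sym (concatMap-++ _ pre (t ∷ post))) ⟩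
      mulS (factorS t (coef t)) (prodF (factors coef M (pre ++ t ∷ post))) j
    ∎

  factors-one-more : ∀ coef N M t .{{_ : NonZero t}} → (∀ k → k ≢ t → N k ≡ M k) → N t ≡ suc (M t) →
    ∀ d j → j ≤ d → prodF (factors coef N (applyUpTo suc d)) j
                   ≈ mulS (factorS t (coef t)) (prodF (factors coef M (applyUpTo suc d))) j
  factors-one-more coef N M (suc t′) N≡M Nt≡1+Mt d j j≤d with suc t′ ≤? d
  ... | yes t≤d = P.subst (λ ks → prodF (factors coef N ks) j
                                  ≈ mulS (factorS (suc t′) (coef (suc t′))) (prodF (factors coef M ks)) j)
                          (P.sym range) (factors-extract coef N M (suc t′) pre post below above Nt≡1+Mt j)
    where
      e : ℕ
      e = d ∸ suc t′
      pre post : List ℕ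
      pre = applyUpTo suc t′
      post = applyUpTo (λ i → suc (suc (t′ +ℕ i))) e
      range : applyUpTo suc d ≡ pre ++ suc t′ ∷ post
      range = P.trans (P.cong (applyUpTo suc) (P.sym (P.trans (ℕₚ.+-suc t′ e) (ℕₚ.m+[n∸m]≡n t≤d))))
                      (applyUpTo-split suc t′ e)
      below : All (λ k → N k ≡ M k) pre
      below = All.map (N≡M _) (applyUpTo⁺₁ suc t′ (λ i<t′ eq → ℕₚ.<⇒≢ i<t′ (ℕₚ.suc-injective eq)))
      above : All (λ k → N k ≡ M k) post
      above = All.map (N≡M _) (applyUpTo⁺₁ _ e (λ {i} _ eq →
                ℕₚ.<⇒≢ (s≤s (ℕₚ.m≤m+n t′ i)) (P.sym (ℕₚ.suc-injective eq))))
  ... | no t≰d = begin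
      prodF (factors coef N (applyUpTo suc d)) j
    ≡⟨ P.cong (λ ks → prodF ks j) (factors-cong coef N M _ (All.map (N≡M _)
         (applyUpTo⁺₁ suc d (λ i<d eq → t≰d (P.subst (_≤ d) eq i<d))))) ⟩
      prodF (factors coef M (applyUpTo suc d)) j
    ≈⟨ sym (factor-mul-low (suc t′) (coef (suc t′)) (prodF (factors coef M (applyUpTo suc d))) j (ℕₚ.≤-<-trans j≤d (ℕₚ.≰⇒> t≰d))) ⟩
      mulS (factorS (suc t′) (coef (suc t′))) (prodF (factors coef M (applyUpTo suc d))) j
    ∎

  telescope : ∀ n .{{_ : NonZero n}} b f q j → j / n ≡ q →
    f j ≈ sumR (map (λ a → pow (- b) a * mulS (factorS n b) f (j ∸ a *ℕ n)) (upTo (suc q)))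
  telescope n b f zero j j/n≡0 = begin
      f j
    ≈⟨ sym (factor-cancel n b f j) ⟩
      mulS (factorS n b) f j + (- b) * shift n f j
    ≡⟨ P.cong (λ z → mulS (factorS n b) f j + (- b) * z) (shift-≰ f (λ n≤j → ℕₚ.<⇒≱ (m/n≡0⇒m<n j/n≡0) n≤j)) ⟩
      mulS (factorS n b) f j + (- b) * 0#
    ≈⟨ +-cong (sym (*-identityˡ _)) (zeroʳ _) ⟩
      1# * mulS (factorS n b) f j + 0#
    ∎
  telescope n b f (suc q) j j/n≡1+q = begin
      f j
    ≈⟨ sym (factor-cancel n b f j) ⟩
      h j + (- b) * shift n f j
    ≡⟨ P.cong (λ z → h j + (- b) * z) (shift-≤ f n≤j) ⟩
      h j + (- b) * f (j ∸ n)
    ≈⟨ +-congˡ (*-congˡ (telescope n b f q (j ∸ n) [j∸n]/n≡q)) ⟩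
      h j + (- b) * sumR (map (λ a → pow (- b) a * h (j ∸ n ∸ a *ℕ n)) (upTo (suc q)))
    ≈⟨ +-congˡ (sym (sumR-*ˡ (- b) _ (upTo (suc q)))) ⟩
      h j + sumR (map (λ a → (- b) * (pow (- b) a * h (j ∸ n ∸ a *ℕ n))) (upTo (suc q)))
    ≈⟨ +-cong (sym (*-identityˡ _)) (sumR-cong (λ a → trans (sym (*-assoc _ _ _))
         (*-congˡ (reflexive (P.cong h (ℕₚ.∸-+-assoc j n (a *ℕ n)))))) (upTo (suc q))) ⟩
      1# * h j + sumR (map (λ a → pow (- b) (suc a) * h (j ∸ suc a *ℕ n)) (upTo (suc q)))
    ≡⟨ P.sym (sumR-upTo-suc (λ a → pow (- b) a * h (j ∸ a *ℕ n)) (suc q)) ⟩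
      sumR (map (λ a → pow (- b) a * h (j ∸ a *ℕ n)) (upTo (suc (suc q))))
    ∎
    where
      h : Ser
      h = mulS (factorS n b) f
      n≤j : n ≤ j
      n≤j = ℕₚ.≮⇒≥ (λ j<n → contradiction (P.trans (P.sym (m<n⇒m/n≡0 j<n)) j/n≡1+q) (λ ()))
      [j∸n]/n≡q : (j ∸ n) / n ≡ q
      [j∸n]/n≡q = ℕₚ.suc-injective (P.trans (P.sym (m/n≡1+[m∸n]/n n≤j)) j/n≡1+q)

-- The factors of H(u;1) and H(u;P)

module FactorCounts {c ℓ} (R : CommutativeRing c ℓ) (F : FiniteField)
    (irr : (k : ℕ) → List (Poly.Monic F k)) (isEnum : Poly.IsIrrEnum F irr)
    (r s : ℕ) .{{_ : NonZero s}} (ξ : CommutativeRing.Carrier R)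
    (n : ℕ) .{{_ : NonZero n}} (P : Poly.Monic F n) (irrP : Poly.Irreducible F P)
    (decP : Poly.DivDecider F (Poly.toPoly F P)) (dec1 : Poly.DivDecider F (Poly.oneP F)) where

  open CommutativeRing R
  open Series R
  open PowerSeries R
  open SetoidReasoning setoid
  open RingProperties ring using (-‿distribˡ-*)
  open Poly F using (PolyF; Monic; toPoly; oneP; DivDecider; Irreducible)
  open MonicPolynomials F

  ρ : Carrier
  ρ = fromℕ (ratio r s)

  coef : ℕ → Carrier
  coef k = ρ * rootSum s ξ k

  count : (G : PolyF) → DivDecider G → ℕ → ℕ
  count G dec k = length (filter (λ Q → ¬? (dec k Q)) (irr k))

  Hcoeff-as-product : ∀ G (dec : DivDecider G) d →
    Hcoeff R F irr r s ξ G dec d ≡ prodF (factors coef (count G dec) (applyUpTo suc d)) d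
  Hcoeff-as-product G dec d = P.cong (λ fs → prodS fs d) (P.trans
    (concatMap-cong (λ k → map-const (factorS k (coef k)) (filter (λ Q → ¬? (dec k Q)) (irr k))) (applyUpTo suc d))
    (P.sym (P.trans (map-concatMap (uncurry factorS) _ (applyUpTo suc d))
                    (concatMap-cong (λ k → map-replicate (uncurry factorS) (count G dec k) (k , coef k)) (applyUpTo suc d)))))

  irreducible : ∀ {k} {Q : Monic k} → Q ∈ irr k → Irreducible Q
  irreducible {k} {Q} Q∈irr = Equivalence.to (proj₁ isEnum k Q) Q∈irr

  count-one : ∀ k → count oneP dec1 k ≡ length (irr k)
  count-one k = P.cong length (filter-all (λ Q → ¬? (dec1 k Q))
    (All.tabulate (λ {Q} Q∈irr → monic-∤-one Q (proj₁ (irreducible Q∈irr)))))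

  count-P-off : ∀ k → k ≢ n → count (toPoly P) decP k ≡ length (irr k)
  count-P-off k k≢n = P.cong length (filter-all (λ Q → ¬? (decP k Q))
    (All.tabulate (λ {Q} Q∈irr Q∣P →
      let (c , c≢0 , P≈Qc) = divisor-is-multiple Q P (proj₁ (irreducible Q∈irr)) irrP Q∣P
      in k≢n (multiple-degree Q P c c≢0 P≈Qc))))

  count-P-at : length (irr n) ≡ suc (count (toPoly P) decP n)
  count-P-at = length-reject-unique (decP n) (irr n) (proj₂ isEnum n)
    (Equivalence.from (proj₁ isEnum n P) irrP) (divides-self P)
    (λ Q Q∈irr Q∣P → let (c , _ , P≈Qc) = divisor-is-multiple Q P (proj₁ (irreducible Q∈irr)) irrP Q∣P
                     in multiple-equal Q P c P≈Qc)

  HP : ℕ → Ser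
  HP d = prodF (factors coef (count (toPoly P) decP) (applyUpTo suc d))

  Hcoeff-one : ∀ d m → m ≤ d → Hcoeff R F irr r s ξ oneP dec1 m ≈ mulS (factorS n (coef n)) (HP d) m
  Hcoeff-one d m m≤d = begin
      Hcoeff R F irr r s ξ oneP dec1 m
    ≡⟨ Hcoeff-as-product oneP dec1 m ⟩
      prodF (factors coef (count oneP dec1) (applyUpTo suc m)) m
    ≈⟨ sym (factors-truncate coef (count oneP dec1) m d m≤d m ℕₚ.≤-refl) ⟩
      prodF (factors coef (count oneP dec1) (applyUpTo suc d)) m
    ≈⟨ factors-one-more coef (count oneP dec1) (count (toPoly P) decP) n
         (λ k k≢n → P.trans (count-one k) (P.sym (count-P-off k k≢n)))
         (P.trans (count-one n) count-P-at) d m m≤d ⟩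
      mulS (factorS n (coef n)) (HP d) m
    ∎

  tuple-weight : ∀ a → pow (- ρ) a * sumR (map (λ is → pow ξ (n *ℕ sum is)) (tuples s a)) ≈ pow (- coef n) a
  tuple-weight a = begin
      pow (- ρ) a * sumR (map (λ is → pow ξ (n *ℕ sum is)) (tuples s a))
    ≈⟨ *-congˡ (tuples-sum s n ξ a) ⟩
      pow (- ρ) a * pow (rootSum s ξ n) a
    ≈⟨ sym (pow-* (- ρ) (rootSum s ξ n) a) ⟩
      pow (- ρ * rootSum s ξ n) a
    ≈⟨ pow-cong a (sym (-‿distribˡ-* ρ (rootSum s ξ n))) ⟩
      pow (- coef n) a
    ∎

-- Lemma 4.5.
lemma4p5 : ∀ {c ℓ} (R : CommutativeRing c ℓ) (F : FiniteField)
  (irr : (k : ℕ) → List (Poly.Monic F k)) → Poly.IsIrrEnum F irr →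
  (r s : ℕ) → .{{_ : NonZero s}} → 2 ≤ r → s ∣ r →
  (ξ : CommutativeRing.Carrier R) → Series.IsPrimitiveRoot R s ξ →
  (n : ℕ) → .{{_ : NonZero n}} → (P : Poly.Monic F n) → Poly.Irreducible F P →
  (decP : Poly.DivDecider F (Poly.toPoly F P)) →
  (dec1 : Poly.DivDecider F (Poly.oneP F)) →
  (d : ℕ) →
  let open CommutativeRing R
      open Series R
  in Hcoeff R F irr r s ξ (Poly.toPoly F P) decP d
     ≈ sumR (map (λ a → pow (- fromℕ (ratio r s)) a
                        * sumR (map (λ is → pow ξ (n *ℕ sum is)) (tuples s a))
                        * Hcoeff R F irr r s ξ (Poly.oneP F) dec1 (d ∸ a *ℕ n))
                 (upTo (suc (d / n))))
lemma4p5 R F irr isEnum r s _ _ ξ _ n P irrP decP dec1 d = begin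
    Hcoeff R F irr r s ξ (toPoly P) decP d
  ≡⟨ Hcoeff-as-product (toPoly P) decP d ⟩
    HP d d
  ≈⟨ telescope n (coef n) (HP d) (d / n) d P.refl ⟩
    sumR (map (λ a → pow (- coef n) a * mulS (factorS n (coef n)) (HP d) (d ∸ a *ℕ n)) (upTo (suc (d / n))))
  ≈⟨ sumR-cong (λ a → sym (*-cong (tuple-weight a) (Hcoeff-one d (d ∸ a *ℕ n) (ℕₚ.m∸n≤m d (a *ℕ n)))))
               (upTo (suc (d / n))) ⟩
    _
  ∎
  where
    open CommutativeRing R
    open Series R
    open PowerSeries R
    open SetoidReasoning setoid
    open Poly F using (toPoly)
    open FactorCounts R F irr isEnum r s ξ n P irrP decP dec1
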